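{- Let $G$ be a non-bipartite Eulerian graph with spanning tree $T$, and let $e\in\operatorname{supp}(\gamma_T)$ be arbitrary. Let $S_1=M_2(E^c(T)\setminus\{e\})$ (viewed inside $M_2(E^c(T))$) and $S_2=M_2(E^c(T))\setminus S_1$. Then $S_2=\{\gamma+\gamma_T:\gamma\in S_1\}$ and $S_1=\{\gamma+\gamma_T:\gamma\in S_2\}$.
   Context: A graph is connected and finite, loops and multiple edges allowed; it is Eulerian if it has a closed walk traversing every edge exactly once. $E^c(T)$ is the set of edges not in $T$; for a set $S$ of edges, $M_2(S)$ is the $\mathbb Z/2\mathbb Z$-vector space of formal sums $\sum_{e\in S}c_e e$; $\operatorname{supp}(\gamma)=\{e:c_e=1\}$. The canonical element $\gamma_T\in M_2(E^c(T))$ has $c_e=0$ if the unique path in $T$ joining the endpoints of $e$ has odd length, and $c_e=1$ otherwise. -}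

module Defs where

open import Data.Nat using (ℕ; zero; suc)
open import Data.Fin using (Fin) renaming (_≟_ to _≟F_)
open import Data.Bool using (Bool; true; false; _xor_)
open import Data.Vec using (Vec; lookup; zipWith)
open import Data.List using (List; []; _∷_; length; filter)
open import Data.List.Relation.Unary.All using (All)
open import Data.List.Relation.Unary.Unique.Propositional using (Unique)
open import Data.Product using (Σ; ∃; ∃-syntax; _×_; _,_)
open import Data.Sum using (_⊎_)
open import Relation.Nullary using (¬_)
open import Relation.Binary.PropositionalEquality using (_≡_)
open import Data.Nat.Base using (_%_)
open import Function.Bundles using (_⇔_)

record Multigraph (n m : ℕ) : Set where
  field
    src : Fin m → Fin n
    tgt : Fin m → Fin n
open Multigraph public

module _ {n m : ℕ} (G : Multigraph n m) where

  Joins : Fin m → Fin n → Fin n → Set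
  Joins e u w = (src G e ≡ u × tgt G e ≡ w) ⊎ (src G e ≡ w × tgt G e ≡ u)

  data Walk : Fin n → Fin n → Set where
    []   : ∀ {u} → Walk u u
    step : ∀ {u w v} (e : Fin m) → Joins e u w → Walk w v → Walk u v

  edgesW : ∀ {u v} → Walk u v → List (Fin m)
  edgesW [] = []
  edgesW (step e _ p) = e ∷ edgesW p

  vertsW : ∀ {u v} → Walk u v → List (Fin n)
  vertsW {u} [] = u ∷ []
  vertsW {u} (step e _ p) = u ∷ vertsW p

  lengthW : ∀ {u v} → Walk u v → ℕ
  lengthW p = length (edgesW p)

  Connected : Set
  Connected = ∀ u v → Walk u v

  Eulerian : Set
  Eulerian = Connected × (∃[ u ] Σ (Walk u u) λ w → ∀ e → length (filter (e ≟F_) (edgesW w)) ≡ 1)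

  Bipartite : Set
  Bipartite = Σ (Fin n → Bool) λ c → ∀ e → ¬ (c (src G e) ≡ c (tgt G e))

  EdgeSet : Set
  EdgeSet = Fin m → Bool

  WalkIn : EdgeSet → ∀ {u v} → Walk u v → Set
  WalkIn T p = All (λ e → T e ≡ true) (edgesW p)

  IsPath : ∀ {u v} → Walk u v → Set
  IsPath p = Unique (vertsW p)

  IsCycle : ∀ {u} → Walk u u → Set
  IsCycle [] = Data.Empty.⊥
    where import Data.Empty
  IsCycle (step e j p) = Unique (edgesW (step e j p)) × Unique (vertsW p)

  IsSpanningTree : EdgeSet → Set
  IsSpanningTree T =
    (∀ u v → Σ (Walk u v) (WalkIn T)) ×
    (∀ u (c : Walk u u) → WalkIn T c → ¬ IsCycle c)

  -- M₂(E^c(T)): formal Z/2-sums over edges, coefficient vector with zero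
  -- coefficients on tree edges
  InM2 : EdgeSet → Vec Bool m → Set
  InM2 T γ = ∀ e → T e ≡ true → lookup γ e ≡ false

  _⊕_ : Vec Bool m → Vec Bool m → Vec Bool m
  γ ⊕ δ = zipWith _xor_ γ δ

  Even : ℕ → Set
  Even k = (k % 2) ≡ 0

  IsCanonical : EdgeSet → Vec Bool m → Set
  IsCanonical T γ = InM2 T γ ×
    (∀ e → T e ≡ false → (p : Walk (src G e) (tgt G e)) → WalkIn T p → IsPath p →
       (lookup γ e ≡ true ⇔ Even (lengthW p)))

{-# OPTIONS --safe #-}
-- Only γ_T ∈ M₂(E^c(T)) and c_e(γ_T) = 1 are needed; the Eulerian, non-bipartite,
-- spanning-tree and parity hypotheses are not. Translation by γ_T is an involution of
-- M₂(E^c(T)) that flips the e-coefficient, so it maps S₁ into S₂ and S₂ into S₁, and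
-- each of the two sets is therefore exactly the image of the other.
module Submission where

open import Defs
open import Data.Nat using (ℕ)
open import Data.Fin using (Fin)
open import Data.Bool using (Bool; true; false; _xor_)
open import Data.Bool.Properties using (xor-assoc; xor-same; xor-identityʳ; ¬-not; not-¬)
open import Data.Vec using (Vec; lookup; zipWith; replicate)
open import Data.Vec.Properties
  using (lookup-zipWith; zipWith-assoc; zipWith-inverseʳ; zipWith-identityʳ; map-id)
open import Data.Product using (Σ; _×_; _,_)
open import Relation.Nullary using (¬_)
open import Relation.Binary.PropositionalEquality using (_≡_; refl; sym; trans; cong; cong₂; module ≡-Reasoning)
open import Function.Bundles using (_⇔_; mk⇔)

image-of-involution : ∀ {a p q} {A : Set a} {P : A → Set p} {Q : A → Set q} (f : A → A) →
  (∀ x → f (f x) ≡ x) → (∀ x → P x → Q (f x)) → (∀ x → Q x → P (f x)) →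
  (y : A) → Q y ⇔ Σ A (λ x → P x × y ≡ f x)
image-of-involution f involutive P→Q Q→P y = mk⇔
  (λ Qy → f y , Q→P y Qy , sym (involutive y))
  (λ { (x , Px , refl) → P→Q x Px })

module _ {n m : ℕ} (G : Multigraph n m) where

  ⊕-cancelʳ : (a b : Vec Bool m) → _⊕_ G (_⊕_ G a b) b ≡ a
  ⊕-cancelʳ a b = begin
    zipWith _xor_ (zipWith _xor_ a b) b  ≡⟨ zipWith-assoc xor-assoc a b b ⟩
    zipWith _xor_ a (zipWith _xor_ b b)  ≡⟨ cong (zipWith _xor_ a) b⊕b≡0 ⟩
    zipWith _xor_ a (replicate m false)  ≡⟨ zipWith-identityʳ xor-identityʳ a ⟩
    a                                    ∎
    where
    open ≡-Reasoning
    b⊕b≡0 : zipWith _xor_ b b ≡ replicate m false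
    b⊕b≡0 = trans (cong (zipWith _xor_ b) (sym (map-id b))) (zipWith-inverseʳ xor-same b)

  lookup-⊕ : (a b : Vec Bool m) (i : Fin m) → lookup (_⊕_ G a b) i ≡ lookup a i xor lookup b i
  lookup-⊕ a b i = lookup-zipWith _xor_ i a b

  InM2-⊕ : (T : EdgeSet G) (a b : Vec Bool m) → InM2 G T a → InM2 G T b → InM2 G T (_⊕_ G a b)
  InM2-⊕ T a b a∈M₂ b∈M₂ i i∈T = trans (lookup-⊕ a b i) (cong₂ _xor_ (a∈M₂ i i∈T) (b∈M₂ i i∈T))

module Translation {n m : ℕ} (G : Multigraph n m) (T : EdgeSet G)
         (γT : Vec Bool m) (γT∈M₂ : InM2 G T γT) (e : Fin m) (γT[e] : lookup γT e ≡ true) where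

  S₁ : Vec Bool m → Set
  S₁ γ = InM2 G T γ × lookup γ e ≡ false

  S₂ : Vec Bool m → Set
  S₂ γ = InM2 G T γ × ¬ S₁ γ

  S₁→S₂ : ∀ γ → S₁ γ → S₂ (_⊕_ G γ γT)
  S₁→S₂ γ (γ∈M₂ , γ[e]) = InM2-⊕ G T γ γT γ∈M₂ γT∈M₂ , λ (_ , γ⊕γT[e]) → not-¬ flipped γ⊕γT[e]
    where
    flipped : lookup (_⊕_ G γ γT) e ≡ true
    flipped = trans (lookup-⊕ G γ γT e) (cong₂ _xor_ γ[e] γT[e])

  S₂→S₁ : ∀ γ → S₂ γ → S₁ (_⊕_ G γ γT)
  S₂→S₁ γ (γ∈M₂ , ¬S₁γ) = InM2-⊕ G T γ γT γ∈M₂ γT∈M₂ , flipped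
    where
    γ[e] : lookup γ e ≡ true
    γ[e] = ¬-not (λ γ[e]≡false → ¬S₁γ (γ∈M₂ , γ[e]≡false))
    flipped : lookup (_⊕_ G γ γT) e ≡ false
    flipped = trans (lookup-⊕ G γ γT e) (cong₂ _xor_ γ[e] γT[e])

lemma6p7 : {n m : ℕ} (G : Multigraph n m) → Eulerian G → ¬ Bipartite G →
    (T : EdgeSet G) → IsSpanningTree G T →
    (γT : Vec Bool m) → IsCanonical G T γT →
    (e : Fin m) → lookup γT e ≡ true →
    let S₁ : Vec Bool m → Set
        S₁ γ = InM2 G T γ × lookup γ e ≡ false
        S₂ : Vec Bool m → Set
        S₂ γ = InM2 G T γ × ¬ S₁ γ
    in ((δ : Vec Bool m) → S₂ δ ⇔ Σ (Vec Bool m) (λ γ → S₁ γ × δ ≡ _⊕_ G γ γT))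
     × ((δ : Vec Bool m) → S₁ δ ⇔ Σ (Vec Bool m) (λ γ → S₂ γ × δ ≡ _⊕_ G γ γT))
lemma6p7 G _ _ T _ γT (γT∈M₂ , _) e γT[e] =
    image-of-involution translate translate-involutive S₁→S₂ S₂→S₁
  , image-of-involution translate translate-involutive S₂→S₁ S₁→S₂
  where
  translate : Vec Bool _ → Vec Bool _
  translate γ = _⊕_ G γ γT
  translate-involutive : ∀ γ → translate (translate γ) ≡ γ
  translate-involutive γ = ⊕-cancelʳ G γ γT
  open Translation G T γT γT∈M₂ e γT[e]
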